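{- Let $G$ be a finite simple $C_4$-free graph and let $v$ be a vertex of maximum degree in $G$. Then $\sum_{e\in D_v(0)} |\mathrm{Sect}_e(2)| \le 2\,|D_v(2)|$.
   Context: A graph is $C_4$-free if it contains no cycle of length four as a subgraph. Distances are shortest-path lengths in $G$; the distance between a vertex $v$ and an edge $f$ is $\min_{u\in f}\mathrm{dist}_G(u,v)$ and the distance between edges $e,f$ is $\min_{x\in e,y\in f}\mathrm{dist}_G(x,y)$. For integers $k,\ell$ let $D_v(k,\ell)=\{\{x,y\}\in E(G):\mathrm{dist}_G(x,v)=k,\ \mathrm{dist}_G(y,v)=\ell\}$ and $D_v(k)=D_v(k,k)\cup D_v(k,k+1)$; in particular $D_v(0)$ is the set of edges incident to $v$. For $e\in D_v(0)$, $\mathrm{Sect}_e(2)=\{f\in D_v(2):\mathrm{dist}_G(v,f)=2,\ \mathrm{dist}_G(e,f)=1\}$. -}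

module Defs where

open import Data.Nat using (ℕ; zero; suc; _+_; _≤_; _<ᵇ_; _≡ᵇ_)
open import Data.Bool using (Bool; true; false; _∧_; _∨_; not; T)
open import Data.Fin using (Fin; toℕ)
open import Data.Fin.Properties using (_≟_)
open import Data.List using (List; []; _∷_; filter; length; map; concatMap)
open import Data.Bool.ListAction using (any)
open import Data.List.Base using (allFin)
open import Data.Product using (_×_; _,_; proj₁; proj₂)
open import Relation.Binary.PropositionalEquality using (_≡_; _≢_)
open import Relation.Nullary using (¬_)
open import Relation.Nullary.Decidable using (⌊_⌋)

record Graph : Set where
  field
    n     : ℕ
    adj   : Fin n → Fin n → Bool
    sym   : ∀ x y → adj x y ≡ adj y x
    irrefl : ∀ x → adj x x ≡ false

module _ (G : Graph) where
  open Graph G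

  Vertex : Set
  Vertex = Fin n

  vertices : List Vertex
  vertices = allFin n

  eqV : Vertex → Vertex → Bool
  eqV x y = ⌊ x ≟ y ⌋

  C4Free : Set
  C4Free = ∀ (a b c d : Vertex) →
    a ≢ b → a ≢ c → a ≢ d → b ≢ c → b ≢ d → c ≢ d →
    ¬ (T (adj a b) × T (adj b c) × T (adj c d) × T (adj d a))

  degree : Vertex → ℕ
  degree x = length (filter (λ y → T? (adj x y)) vertices)
    where
    open import Data.Bool.Properties using () renaming (T? to T?)

  within : ℕ → Vertex → Vertex → Bool
  within zero x y = eqV x y
  within (suc k) x y = within k x y ∨ any (λ z → within k x z ∧ adj z y) vertices

  -- distEq k x y = true iff dist_G(x,y) = k (shortest-path length exactly k;
  -- never true if x and y lie in different components).
  distEq : ℕ → Vertex → Vertex → Bool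
  distEq zero x y = within zero x y
  distEq (suc k) x y = within (suc k) x y ∧ not (within k x y)

  -- Edges, each unordered edge {x,y} listed once as (x,y) with x < y.
  Edge : Set
  Edge = Vertex × Vertex

  edges : List Edge
  edges = filter (λ e → T? (isEdge e)) (concatMap (λ x → map (x ,_) vertices) vertices)
    where
    open import Data.Bool.Properties using () renaming (T? to T?)
    isEdge : Edge → Bool
    isEdge (x , y) = (toℕ x <ᵇ toℕ y) ∧ adj x y

  -- dist(v, f) = k  where f = {x,y}: min of dist(v,x), dist(v,y) equals k
  distVEdgeEq : ℕ → Vertex → Edge → Bool
  distVEdgeEq k v (x , y) =
    (distEq k v x ∨ distEq k v y) ∧ not (within' k v x ∨ within' k v y)
    where
    within' : ℕ → Vertex → Vertex → Bool
    within' zero _ _ = false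
    within' (suc j) a b = within j a b

  -- dist(e, f) = k: min over x ∈ e, y ∈ f of dist(x,y) equals k
  distEdgeEdgeEq : ℕ → Edge → Edge → Bool
  distEdgeEdgeEq k (a , b) f = anyEq ∧ not anyLess
    where
    ends : Edge → List Vertex
    ends (x , y) = x ∷ y ∷ []
    strictly : ℕ → Vertex → Vertex → Bool
    strictly zero _ _ = false
    strictly (suc j) x y = within j x y
    anyEq = any (λ x → any (λ y → distEq k x y) (ends f)) (a ∷ b ∷ [])
    anyLess = any (λ x → any (λ y → strictly k x y) (ends f)) (a ∷ b ∷ [])

  inD : Vertex → ℕ → ℕ → Edge → Bool
  inD v k l (x , y) = (distEq k x v ∧ distEq l y v) ∨ (distEq k y v ∧ distEq l x v)

  inDk : Vertex → ℕ → Edge → Bool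
  inDk v k e = inD v k k e ∨ inD v k (suc k) e

  Dv : Vertex → ℕ → List Edge
  Dv v k = filter (λ e → T? (inDk v k e)) edges
    where open import Data.Bool.Properties using () renaming (T? to T?)

  Sect2 : Vertex → Edge → List Edge
  Sect2 v e = filter (λ f → T? (distVEdgeEq 2 v f ∧ distEdgeEdgeEq 1 e f)) (Dv v 2)
    where open import Data.Bool.Properties using () renaming (T? to T?)

  IsMaxDegree : Vertex → Set
  IsMaxDegree v = ∀ w → degree w ≤ degree v

module Submission where

-- Both sides are counted through the incidence relation
-- "e ∈ D_v(0) and f ∈ Sect_e(2)".  Double counting turns the left-hand side
-- into a sum over f ∈ D_v(2) of the number of spokes e ∈ D_v(0) with
-- f ∈ Sect_e(2), so it suffices to bound that number by 2 for each f.
-- Both endpoints x, y of f ∈ D_v(2) lie at distance at least 2 from v, so a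
-- spoke e = {v,u} at distance 1 from f must have its outer endpoint u adjacent
-- to x or to y.  A vertex w at distance at least 2 from v is adjacent to the
-- outer endpoint of at most one spoke: two such spokes {v,u₁}, {v,u₂} would
-- give the 4-cycle v u₁ w u₂.  Hence at most 2 spokes qualify.
--
-- The
-- bound holds for every vertex v.

open import Defs
open import Data.Nat using (_≤_; _*_)
open import Data.List using (map; length)
open import Data.Nat.ListAction using (sum)

open import Data.Bool using (Bool; true; false; T; _∧_; _∨_; not)
open import Data.Bool.Properties using (T?; T-∧; T-∨; T-not-≡)
open import Data.Empty using (⊥-elim)
open import Data.Fin using (toℕ)
open import Data.Fin.Properties using (_≟_)
open import Data.List using (List; []; _∷_; _++_; filter; concatMap; cartesianProduct)
open import Data.List.Properties using (map-cong)
open import Data.List.Membership.Propositional using (_∈_; lose; find)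
open import Data.List.Membership.Propositional.Properties using (∈-allFin; ∈-filter⁻)
open import Data.List.Relation.Unary.All as All using ()
open import Data.List.Relation.Unary.AllPairs using (_∷_)
open import Data.List.Relation.Unary.Any using (here; there)
open import Data.List.Relation.Unary.Any.Properties using (any⁺; any⁻)
open import Data.List.Relation.Unary.Unique.Propositional using (Unique)
import Data.List.Relation.Unary.Unique.Propositional.Properties as Unique
open import Data.Nat using (ℕ; zero; suc; _+_; z≤n; s≤s; _<ᵇ_)
open import Data.Nat.Properties
  using (module ≤-Reasoning; ≤-refl; ≤-trans; +-mono-≤; +-suc; *-suc; m≤n+m; <-asym; <ᵇ⇒<;
         +-commutativeSemigroup)
open import Data.Product using (Σ-syntax; _×_; _,_; proj₁; proj₂)
open import Data.Sum using (_⊎_; inj₁; inj₂)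
open import Function using (_∘_)
open import Algebra.Properties.CommutativeSemigroup +-commutativeSemigroup using (interchange)
open import Function.Bundles using (module Equivalence)
open import Relation.Binary.PropositionalEquality
  using (_≡_; _≢_; ≢-sym; refl; cong; sym; subst; module ≡-Reasoning)
open import Relation.Nullary using (¬_; yes; no)
open import Relation.Nullary.Decidable using (toWitness; fromWitness)

open Equivalence using (to; from)

indicator : Bool → ℕ
indicator true  = 1
indicator false = 0

module _ {B : Set} where

  sum-map-+ : (f g : B → ℕ) (ys : List B) →
    sum (map (λ y → f y + g y) ys) ≡ sum (map f ys) + sum (map g ys)
  sum-map-+ f g []       = refl
  sum-map-+ f g (y ∷ ys) = begin
    (f y + g y) + sum (map (λ y → f y + g y) ys)   ≡⟨ cong (f y + g y +_) (sum-map-+ f g ys) ⟩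
    (f y + g y) + (sum (map f ys) + sum (map g ys)) ≡⟨ interchange (f y) (g y) _ _ ⟩
    (f y + sum (map f ys)) + (g y + sum (map g ys)) ∎
    where open ≡-Reasoning

  sum-map-0 : (ys : List B) → sum (map (λ _ → 0) ys) ≡ 0
  sum-map-0 []       = refl
  sum-map-0 (y ∷ ys) = sum-map-0 ys

  sum-map-≤ : (c : ℕ) (g : B → ℕ) (ys : List B) →
    (∀ {y} → y ∈ ys → g y ≤ c) → sum (map g ys) ≤ c * length ys
  sum-map-≤ c g []       bound = z≤n
  sum-map-≤ c g (y ∷ ys) bound =
    subst (g y + sum (map g ys) ≤_) (sym (*-suc c (length ys)))
      (+-mono-≤ (bound (here refl)) (sum-map-≤ c g ys (bound ∘ there)))

sum-swap : {A B : Set} (f : A → B → ℕ) (xs : List A) (ys : List B) →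
  sum (map (λ x → sum (map (f x) ys)) xs) ≡ sum (map (λ y → sum (map (λ x → f x y) xs)) ys)
sum-swap f []       ys = sym (sum-map-0 ys)
sum-swap f (x ∷ xs) ys = begin
  sum (map (f x) ys) + sum (map (λ x → sum (map (f x) ys)) xs)
    ≡⟨ cong (sum (map (f x) ys) +_) (sum-swap f xs ys) ⟩
  sum (map (f x) ys) + sum (map (λ y → sum (map (λ x → f x y) xs)) ys)
    ≡⟨ sym (sum-map-+ (f x) (λ y → sum (map (λ x → f x y) xs)) ys) ⟩
  sum (map (λ y → f x y + sum (map (λ x → f x y) xs)) ys) ∎
  where open ≡-Reasoning

module _ {A : Set} where

  count : (A → Bool) → List A → ℕ
  count p xs = sum (map (indicator ∘ p) xs)

  length-filter≡count : (p : A → Bool) (xs : List A) →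
    length (filter (T? ∘ p) xs) ≡ count p xs
  length-filter≡count p []       = refl
  length-filter≡count p (x ∷ xs) with p x
  ... | true  = cong suc (length-filter≡count p xs)
  ... | false = length-filter≡count p xs

  count-none : (p : A → Bool) (xs : List A) →
    (∀ {x} → x ∈ xs → ¬ T (p x)) → count p xs ≡ 0
  count-none p []       none = refl
  count-none p (x ∷ xs) none with p x in px
  ... | true  = ⊥-elim (none (here refl) (subst T (sym px) _))
  ... | false = count-none p xs (none ∘ there)

  count≤1 : (p : A → Bool) (xs : List A) → Unique xs →
    (∀ {a b} → a ∈ xs → b ∈ xs → T (p a) → T (p b) → a ≡ b) → count p xs ≤ 1
  count≤1 p []       _          _   = z≤n
  count≤1 p (x ∷ xs) (x∉xs ∷ u) one with p x in px
  ... | true  = subst (λ k → suc k ≤ 1) (sym (count-none p xs x-only)) ≤-refl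
    where
    x-only : ∀ {b} → b ∈ xs → ¬ T (p b)
    x-only b∈xs pb = All.lookup x∉xs b∈xs (sym (one (there b∈xs) (here refl) pb (subst T (sym px) _)))
  ... | false = count≤1 p xs u (λ a∈ b∈ → one (there a∈) (there b∈))

  count-mono : (p q : A → Bool) (xs : List A) →
    (∀ {x} → x ∈ xs → T (p x) → T (q x)) → count p xs ≤ count q xs
  count-mono p q []       p⇒q = z≤n
  count-mono p q (x ∷ xs) p⇒q with p x in px | q x in qx
  ... | true  | true  = s≤s (count-mono p q xs (p⇒q ∘ there))
  ... | true  | false = ⊥-elim (subst T qx (p⇒q (here refl) (subst T (sym px) _)))
  ... | false | b     = ≤-trans (count-mono p q xs (p⇒q ∘ there)) (m≤n+m _ (indicator b))

  count-∨ : (p q : A → Bool) (xs : List A) →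
    count (λ x → p x ∨ q x) xs ≤ count p xs + count q xs
  count-∨ p q []       = z≤n
  count-∨ p q (x ∷ xs) with p x | q x | count-∨ p q xs
  ... | true  | true  | ih = s≤s (≤-trans ih (+-mono-≤ (≤-refl {count p xs}) (m≤n+m _ 1)))
  ... | true  | false | ih = s≤s ih
  ... | false | true  | ih = subst (suc (count (λ x → p x ∨ q x) xs) ≤_)
                                   (sym (+-suc (count p xs) (count q xs))) (s≤s ih)
  ... | false | false | ih = ih

concatMap-rows≡cartesianProduct : {A B : Set} (xs : List A) (ys : List B) →
  concatMap (λ x → map (x ,_) ys) xs ≡ cartesianProduct xs ys
concatMap-rows≡cartesianProduct []       ys = refl
concatMap-rows≡cartesianProduct (x ∷ xs) ys =
  cong (map (x ,_) ys ++_) (concatMap-rows≡cartesianProduct xs ys)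

T-not⇒¬T : ∀ {b} → T (not b) → ¬ T b
T-not⇒¬T nb = subst T (to T-not-≡ nb)

<ᵇ-asym : ∀ {m n} → T (m <ᵇ n) → ¬ T (n <ᵇ m)
<ᵇ-asym {m} {n} m<n n<m = <-asym (<ᵇ⇒< m n m<n) (<ᵇ⇒< n m n<m)

module _ (G : Graph) where
  open Graph G using (adj; irrefl) renaming (sym to adj-symmetric)

  adj-sym : ∀ {x y} → T (adj x y) → T (adj y x)
  adj-sym {x} {y} = subst T (adj-symmetric x y)

  adj⇒≢ : ∀ {x y} → T (adj x y) → x ≢ y
  adj⇒≢ {x} a refl = subst T (irrefl x) a

  eqV-refl : (x : Vertex G) → T (eqV G x x)
  eqV-refl x = fromWitness {a? = x ≟ x} refl

  within1⇒≡⊎adj : ∀ {x y} → T (within G 1 x y) → x ≡ y ⊎ T (adj x y)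
  within1⇒≡⊎adj {x} {y} w with to T-∨ w
  ... | inj₁ x=y = inj₁ (toWitness x=y)
  ... | inj₂ step with find (any⁻ (λ z → eqV G x z ∧ adj z y) (vertices G) step)
  ...   | z , _ , x=z∧zy with to (T-∧ {eqV G x z}) x=z∧zy
  ...     | x=z , zy with toWitness {a? = x ≟ z} x=z
  ...       | refl = inj₂ zy

  adj⇒within1 : ∀ {x y} → T (adj x y) → T (within G 1 x y)
  adj⇒within1 {x} {y} a = from (T-∨ {eqV G x y}) (inj₂
    (any⁺ (λ z → eqV G x z ∧ adj z y) (lose (∈-allFin x) (from T-∧ (eqV-refl x , a)))))

  common-neighbour-unique : C4Free G → ∀ {x y u₁ u₂} → x ≢ y →
    T (adj u₁ x) → T (adj u₁ y) → T (adj u₂ x) → T (adj u₂ y) → u₁ ≡ u₂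
  common-neighbour-unique c4 {x} {y} {u₁} {u₂} x≢y u₁x u₁y u₂x u₂y with u₁ ≟ u₂
  ... | yes u₁=u₂ = u₁=u₂
  ... | no  u₁≢u₂ = ⊥-elim (c4 x u₁ y u₂
          (≢-sym (adj⇒≢ u₁x)) x≢y (≢-sym (adj⇒≢ u₂x)) (adj⇒≢ u₁y) u₁≢u₂ (≢-sym (adj⇒≢ u₂y))
          (adj-sym u₁x , u₁y , adj-sym u₂y , u₂x))

  distEdgeEdge1⇒close-ends : ∀ {a b x y} → T (distEdgeEdgeEq G 1 (a , b) (x , y)) →
    Σ[ p ∈ Vertex G ] Σ[ q ∈ Vertex G ]
      p ∈ a ∷ b ∷ [] × q ∈ x ∷ y ∷ [] × T (within G 1 p q)
  distEdgeEdge1⇒close-ends {a} {b} {x} {y} d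
    with find (any⁻ _ (a ∷ b ∷ []) (proj₁ (to T-∧ d)))
  ... | p , p∈e , somewhere with find (any⁻ _ (x ∷ y ∷ []) somewhere)
  ...   | q , q∈f , pq = p , q , p∈e , q∈f , proj₁ (to (T-∧ {within G 1 p q}) pq)

  edges-unique : Unique (edges G)
  edges-unique = Unique.filter⁺ _
    (subst Unique (sym (concatMap-rows≡cartesianProduct (vertices G) (vertices G)))
      (Unique.cartesianProduct⁺ (Unique.allFin⁺ _) (Unique.allFin⁺ _)))

  edges⇒ordered-adj : ∀ {a b} → (a , b) ∈ edges G → T (toℕ a <ᵇ toℕ b) × T (adj a b)
  edges⇒ordered-adj m =
    to T-∧ (proj₂ (∈-filter⁻ _ {xs = concatMap (λ x → map (x ,_) (vertices G)) (vertices G)} m))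

module AroundVertex (G : Graph) (v : Vertex G) where
  open Graph G using (adj)

  Far : Vertex G → Set
  Far w = ¬ T (within G 1 w v)

  far⇒≢ : ∀ {w} → Far w → w ≢ v
  far⇒≢ far refl = far (from T-∨ (inj₁ (eqV-refl G v)))

  far⇒¬adj : ∀ {w} → Far w → ¬ T (adj w v)
  far⇒¬adj far = far ∘ adj⇒within1 G

  within1⇒within : ∀ k {x y} → T (within G 1 x y) → T (within G (suc k) x y)
  within1⇒within zero    w = w
  within1⇒within (suc k) w = from T-∨ (inj₁ (within1⇒within k w))

  distEq⇒far : ∀ k {w} → T (distEq G (suc (suc k)) w v) → Far w
  distEq⇒far k {w} d = T-not⇒¬T (proj₂ (to (T-∧ {within G (suc (suc k)) w v}) d)) ∘ within1⇒within k

  inD⇒far : ∀ k l {x y} → T (inD G v (suc (suc k)) (suc (suc l)) (x , y)) → Far x × Far y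
  inD⇒far k l {x} {y} i with to (T-∨ {distEq G (suc (suc k)) x v ∧ distEq G (suc (suc l)) y v}) i
  ... | inj₁ xy with to (T-∧ {distEq G (suc (suc k)) x v}) xy
  ...   | dx , dy = distEq⇒far k dx , distEq⇒far l dy
  inD⇒far k l {x} {y} i | inj₂ yx with to (T-∧ {distEq G (suc (suc k)) y v}) yx
  ...   | dy , dx = distEq⇒far l dx , distEq⇒far k dy

  D2⇒far : ∀ {x y} → (x , y) ∈ Dv G v 2 → Far x × Far y
  D2⇒far {x} {y} m with to (T-∨ {inD G v 2 2 (x , y)}) (proj₂ (∈-filter⁻ _ {xs = edges G} m))
  ... | inj₁ i = inD⇒far 0 0 i
  ... | inj₂ i = inD⇒far 0 1 i

  inD0⇒has-v : ∀ l {a b} → T (inD G v 0 l (a , b)) → a ≡ v ⊎ b ≡ v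
  inD0⇒has-v l {a} {b} i with to (T-∨ {distEq G 0 a v ∧ distEq G l b v}) i
  ... | inj₁ ab = inj₁ (toWitness (proj₁ (to (T-∧ {distEq G 0 a v}) ab)))
  ... | inj₂ ba = inj₂ (toWitness (proj₁ (to (T-∧ {distEq G 0 b v}) ba)))

  inDk0⇒has-v : ∀ {a b} → T (inDk G v 0 (a , b)) → a ≡ v ⊎ b ≡ v
  inDk0⇒has-v {a} {b} i with to (T-∨ {inD G v 0 0 (a , b)}) i
  ... | inj₁ i₀ = inD0⇒has-v 0 i₀
  ... | inj₂ i₁ = inD0⇒has-v 1 i₁

  -- A spoke is an edge {v, u} as it occurs in the edge list, where the
  -- orientation is fixed by the order of v and u.
  data Spoke : Edge G → Set where
    outward : ∀ u → T (toℕ v <ᵇ toℕ u) → T (adj u v) → Spoke (v , u)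
    inward  : ∀ u → T (toℕ u <ᵇ toℕ v) → T (adj u v) → Spoke (u , v)

  outer : ∀ {e} → Spoke e → Vertex G
  outer (outward u _ _) = u
  outer (inward  u _ _) = u

  outer-adj : ∀ {e} (s : Spoke e) → T (adj (outer s) v)
  outer-adj (outward _ _ uv) = uv
  outer-adj (inward  _ _ uv) = uv

  D0⇒spoke : ∀ {e} → e ∈ Dv G v 0 → Spoke e
  D0⇒spoke {a , b} m with ∈-filter⁻ _ {xs = edges G} m
  ... | m′ , i with edges⇒ordered-adj G m′ | inDk0⇒has-v {a} {b} i
  ... | a<b , ab | inj₁ refl = outward b a<b (adj-sym G ab)
  ... | a<b , ab | inj₂ refl = inward  a a<b ab

  spoke-injective : ∀ {e₁ e₂} (s₁ : Spoke e₁) (s₂ : Spoke e₂) → outer s₁ ≡ outer s₂ → e₁ ≡ e₂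
  spoke-injective (outward u _ _)   (outward _ _ _)   refl = refl
  spoke-injective (outward u v<u _) (inward  _ u<v _) refl = ⊥-elim (<ᵇ-asym {toℕ v} v<u u<v)
  spoke-injective (inward  u u<v _) (outward _ v<u _) refl = ⊥-elim (<ᵇ-asym {toℕ v} v<u u<v)
  spoke-injective (inward  u _ _)   (inward  _ _ _)   refl = refl

  spoke-ends : ∀ {e p} (s : Spoke e) → p ∈ proj₁ e ∷ proj₂ e ∷ [] → p ≡ v ⊎ p ≡ outer s
  spoke-ends (outward _ _ _) (here refl)         = inj₁ refl
  spoke-ends (outward _ _ _) (there (here refl)) = inj₂ refl
  spoke-ends (inward  _ _ _) (here refl)         = inj₂ refl
  spoke-ends (inward  _ _ _) (there (here refl)) = inj₁ refl

  touches : Vertex G → Edge G → Bool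
  touches w (a , b) = adj a w ∨ adj b w

  touches-spoke⇒adj-outer : ∀ {w e} (s : Spoke e) → Far w → T (touches w e) → T (adj (outer s) w)
  touches-spoke⇒adj-outer {w} (outward _ _ _) far t with to (T-∨ {adj v w}) t
  ... | inj₁ vw = ⊥-elim (far⇒¬adj far (adj-sym G vw))
  ... | inj₂ uw = uw
  touches-spoke⇒adj-outer {w} (inward u _ _) far t with to (T-∨ {adj u w}) t
  ... | inj₁ uw = uw
  ... | inj₂ vw = ⊥-elim (far⇒¬adj far (adj-sym G vw))

  adj-outer⇒touches-spoke : ∀ {w e} (s : Spoke e) → T (adj (outer s) w) → T (touches w e)
  adj-outer⇒touches-spoke {w} (outward _ _ _) uw = from (T-∨ {adj v w}) (inj₂ uw)
  adj-outer⇒touches-spoke     (inward  _ _ _) uw = from T-∨ (inj₁ uw)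

  near-spoke⇒touches : ∀ {x y e} → Far x → Far y → (s : Spoke e) →
    T (distEdgeEdgeEq G 1 e (x , y)) → T (touches x e ∨ touches y e)
  near-spoke⇒touches {x} {y} {e} far-x far-y s d with distEdgeEdge1⇒close-ends G d
  ... | p , q , p∈e , q∈f , pq =
    touch q∈f (outer-adj-q (spoke-ends s p∈e) (within1⇒≡⊎adj G pq))
    where
    far-end : ∀ {z} → z ∈ x ∷ y ∷ [] → Far z
    far-end (here refl)         = far-x
    far-end (there (here refl)) = far-y

    far-q : Far q
    far-q = far-end q∈f

    outer-adj-q : p ≡ v ⊎ p ≡ outer s → p ≡ q ⊎ T (adj p q) → T (adj (outer s) q)
    outer-adj-q (inj₁ refl) (inj₁ refl) = ⊥-elim (far⇒≢ far-q refl)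
    outer-adj-q (inj₁ refl) (inj₂ vq)   = ⊥-elim (far⇒¬adj far-q (adj-sym G vq))
    outer-adj-q (inj₂ refl) (inj₁ refl) = ⊥-elim (far⇒¬adj far-q (outer-adj s))
    outer-adj-q (inj₂ refl) (inj₂ uq)   = uq

    touch : q ∈ x ∷ y ∷ [] → T (adj (outer s) q) → T (touches x e ∨ touches y e)
    touch (here refl)         uq = from T-∨ (inj₁ (adj-outer⇒touches-spoke s uq))
    touch (there (here refl)) uq = from (T-∨ {touches x e}) (inj₂ (adj-outer⇒touches-spoke s uq))

  -- In a C₄-free graph a far vertex touches at most one spoke: the outer
  -- endpoints of two touched spokes are common neighbours of v and w.
  touched-spoke-unique : C4Free G → ∀ {w} → Far w → ∀ {e₁ e₂} →
    e₁ ∈ Dv G v 0 → e₂ ∈ Dv G v 0 → T (touches w e₁) → T (touches w e₂) → e₁ ≡ e₂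
  touched-spoke-unique c4 far m₁ m₂ t₁ t₂ =
    spoke-injective s₁ s₂ (common-neighbour-unique G c4 (≢-sym (far⇒≢ far))
      (outer-adj s₁) (touches-spoke⇒adj-outer s₁ far t₁)
      (outer-adj s₂) (touches-spoke⇒adj-outer s₂ far t₂))
    where
    s₁ : Spoke _
    s₁ = D0⇒spoke m₁
    s₂ : Spoke _
    s₂ = D0⇒spoke m₂

  inSect : Edge G → Edge G → Bool
  inSect e f = distVEdgeEq G 2 v f ∧ distEdgeEdgeEq G 1 e f

  sect-spokes≤2 : C4Free G → ∀ {f} → f ∈ Dv G v 2 → count (λ e → inSect e f) (Dv G v 0) ≤ 2
  sect-spokes≤2 c4 {x , y} m with D2⇒far m
  ... | far-x , far-y = begin
    count (λ e → inSect e (x , y)) D0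
      ≤⟨ count-mono _ _ D0 (λ e∈ i → near-spoke⇒touches far-x far-y (D0⇒spoke e∈)
           (proj₂ (to (T-∧ {distVEdgeEq G 2 v (x , y)}) i))) ⟩
    count (λ e → touches x e ∨ touches y e) D0
      ≤⟨ count-∨ (touches x) (touches y) D0 ⟩
    count (touches x) D0 + count (touches y) D0
      ≤⟨ +-mono-≤ (count≤1 _ D0 D0-unique (touched-spoke-unique c4 far-x))
                  (count≤1 _ D0 D0-unique (touched-spoke-unique c4 far-y)) ⟩
    2 ∎
    where
    open ≤-Reasoning
    D0 : List (Edge G)
    D0 = Dv G v 0
    D0-unique : Unique D0
    D0-unique = Unique.filter⁺ _ (edges-unique G)

lemma9 : (G : Graph) → C4Free G → (v : Vertex G) → IsMaxDegree G v →
    sum (map (λ e → length (Sect2 G v e)) (Dv G v 0)) ≤ 2 * length (Dv G v 2)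
lemma9 G c4 v _ = begin
  sum (map (λ e → length (Sect2 G v e)) D0)
    ≡⟨ cong sum (map-cong (λ e → length-filter≡count (inSect e) D2) D0) ⟩
  sum (map (λ e → count (inSect e) D2) D0)
    ≡⟨ sum-swap (λ e f → indicator (inSect e f)) D0 D2 ⟩
  sum (map (λ f → count (λ e → inSect e f) D0) D2)
    ≤⟨ sum-map-≤ 2 _ D2 (sect-spokes≤2 c4) ⟩
  2 * length D2 ∎
  where
  open AroundVertex G v
  open ≤-Reasoning
  D0 D2 : List (Edge G)
  D0 = Dv G v 0
  D2 = Dv G v 2
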